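{- Let $n\ge 2$ and let $w^{\delta_n}$ be the permutation of $[2n-2]$ with one-line notation $2,4,6,\ldots,2n-2,1,3,5,\ldots,2n-3$. Then the set $\mathcal{R}(w^{\delta_n})$ of reduced words of $w^{\delta_n}$ is a single shifted Knuth class: it is closed under shifted Knuth moves, and any two of its elements are connected by a sequence of shifted Knuth moves.
   Context: Permutations are multiplied as functions ($(uv)(x)=u(v(x))$) and written in one-line notation $w(1)w(2)\cdots$. $s_i$ is the simple transposition $(i,i+1)$. A word $(a_1,\ldots,a_p)$ is a reduced word of $w$ if $w=s_{a_1}s_{a_2}\cdots s_{a_p}$ and $p$ equals the number of inversions of $w$. The Knuth relations on words of integers are $acb\leftrightarrow cab$ when $a\le b<c$, and $bac\leftrightarrow bca$ when $a<b\le c$. A Knuth move on a word applies a Knuth relation to three consecutive letters; a shifted Knuth move is a Knuth move or the exchange of the first two letters of the word. Two words are shifted Knuth equivalent if they are related by a sequence of shifted Knuth moves; the equivalence classes are shifted Knuth classes. -}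

module Defs where

open import Data.Nat using (ℕ; zero; suc; _+_; _*_; _∸_; _≤_; _<_; _<?_; _≤ᵇ_; _≡ᵇ_)
open import Data.Bool using (Bool; true; false; if_then_else_; _∧_)
open import Data.List using (List; []; _∷_; length; filter; map; upTo)
open import Data.Nat.ListAction using (sum)
open import Data.List.Relation.Unary.All using (All)
open import Data.Product using (_×_)
open import Relation.Binary.PropositionalEquality using (_≡_)

swap : ℕ → ℕ → ℕ
swap a x = if x ≡ᵇ a then suc a else (if x ≡ᵇ suc a then a else x)

-- The permutation s_{a1} s_{a2} ... s_{ap}, multiplied as functions:
-- (uv)(x) = u(v(x)).
evalWord : List ℕ → ℕ → ℕ
evalWord []       x = x
evalWord (a ∷ as) x = swap a (evalWord as x)

positions : ℕ → List ℕ
positions m = map suc (upTo m)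

inversions : ℕ → (ℕ → ℕ) → ℕ
inversions m w = sum (map (λ j → length (filter (λ i → w j <? w i) (positions (j ∸ 1)))) (positions m))

IsReducedWord : ℕ → (ℕ → ℕ) → List ℕ → Set
IsReducedWord m w ws =
  All (λ a → 1 ≤ a × a < m) ws
  × (∀ x → 1 ≤ x → x ≤ m → evalWord ws x ≡ w x)
  × length ws ≡ inversions m w

-- w^{δ_n} on [2n-2]: one-line notation 2,4,...,2n-2,1,3,...,2n-3
-- i.e. w(i) = 2i for 1 ≤ i ≤ n-1, w(i) = 2(i-n)+1 for n ≤ i ≤ 2n-2
-- (identity outside [2n-2], irrelevant).
wδ : ℕ → ℕ → ℕ
wδ n i = if (1 ≤ᵇ i) ∧ (i ≤ᵇ (n ∸ 1)) then 2 * i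
         else (if (n ≤ᵇ i) ∧ (i ≤ᵇ (2 * n ∸ 2)) then 2 * (i ∸ n) + 1 else i)

data Knuth3 : List ℕ → List ℕ → Set where
  k1  : ∀ {a b c} → a ≤ b → b < c → Knuth3 (a ∷ c ∷ b ∷ []) (c ∷ a ∷ b ∷ [])
  k1⁻ : ∀ {a b c} → a ≤ b → b < c → Knuth3 (c ∷ a ∷ b ∷ []) (a ∷ c ∷ b ∷ [])
  k2  : ∀ {a b c} → a < b → b ≤ c → Knuth3 (b ∷ a ∷ c ∷ []) (b ∷ c ∷ a ∷ [])
  k2⁻ : ∀ {a b c} → a < b → b ≤ c → Knuth3 (b ∷ c ∷ a ∷ []) (b ∷ a ∷ c ∷ [])

data KnuthMove : List ℕ → List ℕ → Set where
  here  : ∀ {x y z x′ y′ z′ rest} →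
          Knuth3 (x ∷ y ∷ z ∷ []) (x′ ∷ y′ ∷ z′ ∷ []) →
          KnuthMove (x ∷ y ∷ z ∷ rest) (x′ ∷ y′ ∷ z′ ∷ rest)
  there : ∀ {a u v} → KnuthMove u v → KnuthMove (a ∷ u) (a ∷ v)

data ShiftedKnuthMove : List ℕ → List ℕ → Set where
  knuth    : ∀ {u v} → KnuthMove u v → ShiftedKnuthMove u v
  swapHead : ∀ {a b rest} → ShiftedKnuthMove (a ∷ b ∷ rest) (b ∷ a ∷ rest)

{-# OPTIONS --safe #-}
module Submission where

-- Let h = n - 1, so that wδ permutes [2h].  For a word s, regard the values s(1), ..., s(h) as
-- particles on the sites 1, ..., 2h.  The permutation wδ has no inversions inside either half of
-- [2h], only between the halves, and prepending a letter a to s changes the number of such crossing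
-- inversions by at most one, increasing it exactly when, for s, site a is occupied and a + 1 is not.
-- Hence a reduced word of wδ is precisely a run of particle hops from a + 1 down to an empty site a,
-- leading from {2, 4, ..., 2h} to {1, ..., h}.
--
-- Two distinct available hops a < b are far apart, hence commute.  Moreover, after performing both,
-- site a + 1 is empty and site b is occupied, so some hop c with a ≤ c < b becomes available: both
-- a b c ... and b a c ... extend to runs, and they differ by the Knuth move abc ↔ bac.  Induction on
-- the length connects any two runs.  Conversely, a Knuth move on a run only exchanges two letters
-- at distance at least two, and in {2, 4, ..., 2h} the first two hops are never adjacent either, so
-- every shifted Knuth move preserves the permutation.

open import Defs
open import Data.Bool using (true; false)
open import Data.Empty using (⊥; ⊥-elim)
open import Data.List using (List; []; _∷_; _++_; _∷ʳ_; length; map; filter; upTo; applyUpTo)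
open import Data.List.Properties using (map-++; map-∘; map-cong; map-id; map-applyUpTo; applyUpTo-∷ʳ; filter-accept; filter-reject)
open import Data.List.Relation.Unary.All using (All; []; _∷_)
open import Data.Nat
open import Data.Nat.ListAction using (sum)
open import Data.Nat.ListAction.Properties using (sum-++)
open import Data.Nat.Properties
open import Data.Nat.Solver using (module +-*-Solver)
open import Data.Product using (∃; _×_; _,_; proj₁; proj₂)
open import Function using (_∘_; id)
open import Relation.Binary.PropositionalEquality
open import Relation.Binary.Construct.Closure.ReflexiveTransitive using (Star; ε; _◅_; _◅◅_; gmap; fold)
  renaming (map to map⋆)
open import Relation.Binary.Definitions using (tri<; tri≈; tri>)
open import Relation.Nullary using (¬_; Dec; yes; no)
import Relation.Unary as U
open import Relation.Nullary.Decidable using (dec-true; dec-false)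
open +-*-Solver using (solve; _:+_; _:*_; _:=_; con)

≡ᵇ-true : ∀ {x y} → x ≡ y → (x ≡ᵇ y) ≡ true
≡ᵇ-true {x} {y} = dec-true (x ≟ y)

≡ᵇ-false : ∀ {x y} → x ≢ y → (x ≡ᵇ y) ≡ false
≡ᵇ-false {x} {y} = dec-false (x ≟ y)

≤ᵇ-true : ∀ {m n} → m ≤ n → (m ≤ᵇ n) ≡ true
≤ᵇ-true {m} {n} = dec-true (m ≤? n)

≤ᵇ-false : ∀ {m n} → ¬ m ≤ n → (m ≤ᵇ n) ≡ false
≤ᵇ-false {m} {n} = dec-false (m ≤? n)

a≢1+a : ∀ {a} → a ≢ suc a
a≢1+a = 1+n≢n ∘ sym

≡1⇒≢0 : ∀ {n} → n ≡ 1 → n ≢ 0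
≡1⇒≢0 refl ()

≤1∧≢1⇒≡0 : ∀ {n} → n ≤ 1 → n ≢ 1 → n ≡ 0
≤1∧≢1⇒≡0 z≤n _ = refl
≤1∧≢1⇒≡0 (s≤s z≤n) n≢1 = ⊥-elim (n≢1 refl)

odd≢even : ∀ a b → suc (a + a) ≢ b + b
odd≢even zero    zero    ()
odd≢even zero    (suc b) e = 0≢1+n (trans (suc-injective e) (+-suc b b))
odd≢even (suc a) zero    ()
odd≢even (suc a) (suc b) e =
  odd≢even a b (suc-injective (trans (sym (cong suc (+-suc a a))) (trans (suc-injective e) (+-suc b b))))

tight-step : ∀ {x′ x ℓ p q} → x′ + q ≡ x + p → x′ ≡ suc ℓ → x ≤ ℓ → p ≤ 1 → p ≡ 1 × x ≡ ℓ
tight-step {p = zero} {q} eq refl x≤ℓ _ =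
  ⊥-elim (<⇒≱ (<-≤-trans (s≤s x≤ℓ) (m≤m+n _ q)) (≤-reflexive (trans eq (+-identityʳ _))))
tight-step {x = x} {ℓ} {p = suc zero} {q} eq refl x≤ℓ _ =
  refl , ≤-antisym x≤ℓ (≤-pred (≤-trans (m≤m+n (suc ℓ) q) (≤-reflexive (trans eq (+-comm x 1)))))
tight-step {p = suc (suc _)} _ _ _ (s≤s ())

discrete-ivt : ∀ {P : ℕ → Set} → U.Decidable P → ∀ {lo} hi → lo < hi → ¬ P lo → P hi →
               ∃ λ c → lo ≤ c × c < hi × ¬ P c × P (suc c)
discrete-ivt P? {lo} (suc hi) (s≤s lo≤hi) ¬Plo P[1+hi] with P? hi
... | no ¬Phi = hi , lo≤hi , n<1+n hi , ¬Phi , P[1+hi]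
... | yes Phi with discrete-ivt P? hi (≤∧≢⇒< lo≤hi (λ { refl → ¬Plo Phi })) ¬Plo Phi
...   | c , lo≤c , c<hi , ¬Pc , P[1+c] = c , lo≤c , m<n⇒m<1+n c<hi , ¬Pc , P[1+c]

swap-self : ∀ a → swap a a ≡ suc a
swap-self a rewrite ≡ᵇ-true (refl {x = a}) = refl

swap-suc : ∀ a → swap a (suc a) ≡ a
swap-suc a rewrite ≡ᵇ-false (1+n≢n {a}) | ≡ᵇ-true (refl {x = suc a}) = refl

swap-other : ∀ {a x} → x ≢ a → x ≢ suc a → swap a x ≡ x
swap-other x≢a x≢1+a rewrite ≡ᵇ-false x≢a | ≡ᵇ-false x≢1+a = refl

data SwapCase (a : ℕ) : ℕ → Set where
  at-self   : SwapCase a a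
  at-suc    : SwapCase a (suc a)
  elsewhere : ∀ {x} → x ≢ a → x ≢ suc a → SwapCase a x

swapCase : ∀ a x → SwapCase a x
swapCase a x with x ≟ a | x ≟ suc a
... | yes refl | _        = at-self
... | no _     | yes refl = at-suc
... | no x≢a   | no x≢1+a = elsewhere x≢a x≢1+a

swap-involutive : ∀ a x → swap a (swap a x) ≡ x
swap-involutive a x with swapCase a x
... | at-self         = trans (cong (swap a) (swap-self a)) (swap-suc a)
... | at-suc          = trans (cong (swap a) (swap-suc a)) (swap-self a)
... | elsewhere p q   = trans (cong (swap a) (swap-other p q)) (swap-other p q)

map-swap-involutive : ∀ a xs → map (swap a) (map (swap a) xs) ≡ xs
map-swap-involutive a xs = trans (sym (map-∘ xs)) (trans (map-cong (swap-involutive a) xs) (map-id xs))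

Far : ℕ → ℕ → Set
Far a b = a ≢ b × suc a ≢ b × suc b ≢ a

Far-sym : ∀ {a b} → Far a b → Far b a
Far-sym (a≢b , 1+a≢b , 1+b≢a) = (λ b≡a → a≢b (sym b≡a)) , 1+b≢a , 1+a≢b

<-far : ∀ {a c} → a < c → suc a ≢ c → Far a c
<-far a<c 1+a≢c = <⇒≢ a<c , 1+a≢c , >⇒≢ (m<n⇒m<1+n a<c)

swap-fixes : ∀ {a b} → Far a b → swap a b ≡ b
swap-fixes (a≢b , 1+a≢b , _) = swap-other (a≢b ∘ sym) (1+a≢b ∘ sym)

swap-fixes-suc : ∀ {a b} → Far a b → swap a (suc b) ≡ suc b
swap-fixes-suc (a≢b , _ , 1+b≢a) = swap-other 1+b≢a (a≢b ∘ sym ∘ suc-injective)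

swap-comm : ∀ {a b} → Far a b → ∀ x → swap a (swap b x) ≡ swap b (swap a x)
swap-comm {a} {b} far x with swapCase b x
... | at-self rewrite swap-self b | swap-fixes-suc far | swap-fixes far | swap-self b = refl
... | at-suc  rewrite swap-suc b | swap-fixes far | swap-fixes-suc far | swap-suc b = refl
... | elsewhere x≢b x≢1+b with swapCase a x
...   | at-self rewrite swap-other x≢b x≢1+b | swap-self a | swap-fixes-suc (Far-sym far) = refl
...   | at-suc  rewrite swap-other x≢b x≢1+b | swap-suc a | swap-fixes (Far-sym far) = refl
...   | elsewhere x≢a x≢1+a rewrite swap-other x≢b x≢1+b | swap-other x≢a x≢1+a | swap-other x≢b x≢1+b = refl

map-swap-comm : ∀ a b C → Far a b → map (swap a) (map (swap b) C) ≡ map (swap b) (map (swap a) C)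
map-swap-comm a b C far = trans (sym (map-∘ C)) (trans (map-cong (swap-comm far) C) (map-∘ C))

𝟙 : ∀ {P : Set} → Dec P → ℕ
𝟙 (yes _) = 1
𝟙 (no _)  = 0

𝟙-yes : ∀ {P : Set} (p? : Dec P) → P → 𝟙 p? ≡ 1
𝟙-yes (yes _) _  = refl
𝟙-yes (no ¬p) p = ⊥-elim (¬p p)

𝟙-no : ∀ {P : Set} (p? : Dec P) → ¬ P → 𝟙 p? ≡ 0
𝟙-no (yes p) ¬p = ⊥-elim (¬p p)
𝟙-no (no _)  _  = refl

𝟙-cong : ∀ {P Q : Set} (p? : Dec P) (q? : Dec Q) → (P → Q) → (Q → P) → 𝟙 p? ≡ 𝟙 q?
𝟙-cong (yes p) q? P→Q _ = sym (𝟙-yes q? (P→Q p))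
𝟙-cong (no ¬p) q? _ Q→P = sym (𝟙-no q? (¬p ∘ Q→P))

tally : (ℕ → ℕ) → List ℕ → ℕ
tally f xs = sum (map f xs)

tally-++ : ∀ f xs ys → tally f (xs ++ ys) ≡ tally f xs + tally f ys
tally-++ f xs ys = trans (cong sum (map-++ f xs ys)) (sum-++ (map f xs) (map f ys))

tally-map : ∀ f g xs → tally f (map g xs) ≡ tally (f ∘ g) xs
tally-map f g xs = cong sum (sym (map-∘ xs))

tally-cong : ∀ {f g} → (∀ x → f x ≡ g x) → ∀ xs → tally f xs ≡ tally g xs
tally-cong f≗g xs = cong sum (map-cong f≗g xs)

occ : ℕ → List ℕ → ℕ
occ v = tally (λ x → 𝟙 (x ≟ v))

below : ℕ → List ℕ → ℕ
below x = tally (λ y → 𝟙 (y <? x))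

above : ℕ → List ℕ → ℕ
above y = tally (λ x → 𝟙 (y <? x))

inv : List ℕ → ℕ
inv []       = 0
inv (x ∷ xs) = below x xs + inv xs

crossInv : List ℕ → List ℕ → ℕ
crossInv xs ys = tally (λ x → below x ys) xs

occ-map-swap : ∀ a v xs → occ v (map (swap a) xs) ≡ occ (swap a v) xs
occ-map-swap a v xs = trans (tally-map _ (swap a) xs) (tally-cong same-test xs)
  where
  same-test : ∀ x → 𝟙 (swap a x ≟ v) ≡ 𝟙 (x ≟ swap a v)
  same-test x = 𝟙-cong (swap a x ≟ v) (x ≟ swap a v)
    (λ e → trans (sym (swap-involutive a x)) (cong (swap a) e))
    (λ e → trans (cong (swap a) e) (swap-involutive a v))

occ-map-swap-self : ∀ a C → occ a (map (swap a) C) ≡ occ (suc a) C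
occ-map-swap-self a C = trans (occ-map-swap a a C) (cong (λ v → occ v C) (swap-self a))

occ-map-swap-suc : ∀ a C → occ (suc a) (map (swap a) C) ≡ occ a C
occ-map-swap-suc a C = trans (occ-map-swap a (suc a) C) (cong (λ v → occ v C) (swap-suc a))

occ-map-swap-other : ∀ {a v} C → v ≢ a → v ≢ suc a → occ v (map (swap a) C) ≡ occ v C
occ-map-swap-other {a} {v} C v≢a v≢1+a = trans (occ-map-swap a v C) (cong (λ u → occ u C) (swap-other v≢a v≢1+a))

-- Order between two values is unchanged by swapping a and a + 1, except for the pair {a, a + 1}.
𝟙<-swap : ∀ a x y → 𝟙 (swap a y <? swap a x) + 𝟙 (x ≟ suc a) * 𝟙 (y ≟ a)
                  ≡ 𝟙 (y <? x) + 𝟙 (x ≟ a) * 𝟙 (y ≟ suc a)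
𝟙<-swap a x y with swapCase a x | swapCase a y
... | at-self | at-self
  rewrite swap-self a | 𝟙-no (suc a <? suc a) (n≮n _) | 𝟙-no (a <? a) (n≮n a)
        | 𝟙-no (a ≟ suc a) a≢1+a | 𝟙-yes (a ≟ a) refl = refl
... | at-self | at-suc
  rewrite swap-self a | swap-suc a | 𝟙-yes (a <? suc a) (n<1+n a) | 𝟙-no (suc a <? a) (<-asym (n<1+n a))
        | 𝟙-no (a ≟ suc a) a≢1+a | 𝟙-yes (a ≟ a) refl | 𝟙-yes (suc a ≟ suc a) refl = refl
... | at-self | elsewhere y≢a y≢1+a
  rewrite swap-self a | swap-other y≢a y≢1+a | 𝟙-no (a ≟ suc a) a≢1+a | 𝟙-yes (a ≟ a) refl | 𝟙-no (y ≟ suc a) y≢1+a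
  = cong (_+ 0) (𝟙-cong (y <? suc a) (y <? a) (λ y<1+a → ≤∧≢⇒< (m<1+n⇒m≤n y<1+a) y≢a) (m<n⇒m<1+n))
... | at-suc | at-self
  rewrite swap-self a | swap-suc a | 𝟙-no (suc a <? a) (<-asym (n<1+n a)) | 𝟙-yes (a <? suc a) (n<1+n a)
        | 𝟙-yes (suc a ≟ suc a) refl | 𝟙-yes (a ≟ a) refl | 𝟙-no (suc a ≟ a) 1+n≢n = refl
... | at-suc | at-suc
  rewrite swap-suc a | 𝟙-no (a <? a) (n≮n a) | 𝟙-no (suc a <? suc a) (n≮n _)
        | 𝟙-yes (suc a ≟ suc a) refl | 𝟙-no (suc a ≟ a) 1+n≢n = refl
... | at-suc | elsewhere y≢a y≢1+a
  rewrite swap-suc a | swap-other y≢a y≢1+a | 𝟙-yes (suc a ≟ suc a) refl | 𝟙-no (y ≟ a) y≢a | 𝟙-no (suc a ≟ a) 1+n≢n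
  = cong (_+ 0) (𝟙-cong (y <? a) (y <? suc a) m<n⇒m<1+n (λ y<1+a → ≤∧≢⇒< (m<1+n⇒m≤n y<1+a) y≢a))
... | elsewhere x≢a x≢1+a | at-self
  rewrite swap-self a | swap-other x≢a x≢1+a | 𝟙-no (x ≟ suc a) x≢1+a | 𝟙-no (x ≟ a) x≢a
  = cong (_+ 0) (𝟙-cong (suc a <? x) (a <? x) (<-trans (n<1+n a)) (λ a<x → ≤∧≢⇒< a<x (x≢1+a ∘ sym)))
... | elsewhere x≢a x≢1+a | at-suc
  rewrite swap-suc a | swap-other x≢a x≢1+a | 𝟙-no (x ≟ suc a) x≢1+a | 𝟙-no (x ≟ a) x≢a
  = cong (_+ 0) (𝟙-cong (a <? x) (suc a <? x) (λ a<x → ≤∧≢⇒< a<x (x≢1+a ∘ sym)) (<-trans (n<1+n a)))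
... | elsewhere x≢a x≢1+a | elsewhere y≢a y≢1+a
  rewrite swap-other x≢a x≢1+a | swap-other y≢a y≢1+a | 𝟙-no (x ≟ suc a) x≢1+a | 𝟙-no (x ≟ a) x≢a = refl

below-map-swap : ∀ a x ys → below (swap a x) (map (swap a) ys) + 𝟙 (x ≟ suc a) * occ a ys
                          ≡ below x ys + 𝟙 (x ≟ a) * occ (suc a) ys
below-map-swap a x []       = trans (*-zeroʳ (𝟙 (x ≟ suc a))) (sym (*-zeroʳ (𝟙 (x ≟ a))))
below-map-swap a x (y ∷ ys) =
  trans (regroup (𝟙 (swap a y <? swap a x)) (below (swap a x) (map (swap a) ys)) (𝟙 (x ≟ suc a)) (𝟙 (y ≟ a)) (occ a ys))
  (trans (cong₂ _+_ (𝟙<-swap a x y) (below-map-swap a x ys))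
  (sym (regroup (𝟙 (y <? x)) (below x ys) (𝟙 (x ≟ a)) (𝟙 (y ≟ suc a)) (occ (suc a) ys))))
  where
  regroup : ∀ A B p e o → (A + B) + p * (e + o) ≡ (A + p * e) + (B + p * o)
  regroup = solve 5 (λ A B p e o → (A :+ B) :+ p :* (e :+ o) := (A :+ p :* e) :+ (B :+ p :* o)) refl

crossInv-map-swap : ∀ a xs ys → crossInv (map (swap a) xs) (map (swap a) ys) + occ (suc a) xs * occ a ys
                              ≡ crossInv xs ys + occ a xs * occ (suc a) ys
crossInv-map-swap a []       ys = refl
crossInv-map-swap a (x ∷ xs) ys =
  trans (regroup (below (swap a x) (map (swap a) ys)) (crossInv (map (swap a) xs) (map (swap a) ys))
                 (𝟙 (x ≟ suc a)) (occ (suc a) xs) (occ a ys))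
  (trans (cong₂ _+_ (below-map-swap a x ys) (crossInv-map-swap a xs ys))
  (sym (regroup (below x ys) (crossInv xs ys) (𝟙 (x ≟ a)) (occ a xs) (occ (suc a) ys))))
  where
  regroup : ∀ A B p q s → (A + B) + (p + q) * s ≡ (A + p * s) + (B + q * s)
  regroup = solve 5 (λ A B p q s → (A :+ B) :+ (p :+ q) :* s := (A :+ p :* s) :+ (B :+ q :* s)) refl

length-filter≡above : ∀ (f : ℕ → ℕ) y xs → length (filter (λ i → y <? f i) xs) ≡ above y (map f xs)
length-filter≡above f y []       = refl
length-filter≡above f y (x ∷ xs) with y <? f x
... | yes y<fx = trans (cong length (filter-accept (λ i → y <? f i) y<fx)) (cong suc (length-filter≡above f y xs))
... | no y≮fx  = trans (cong length (filter-reject (λ i → y <? f i) y≮fx)) (length-filter≡above f y xs)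

inv-∷ʳ : ∀ xs y → inv (xs ∷ʳ y) ≡ inv xs + above y xs
inv-∷ʳ []       y = refl
inv-∷ʳ (x ∷ xs) y = begin
  below x (xs ∷ʳ y) + inv (xs ∷ʳ y)                   ≡⟨ cong₂ _+_ (tally-++ _ xs (y ∷ [])) (inv-∷ʳ xs y) ⟩
  (below x xs + (𝟙 (y <? x) + 0)) + (inv xs + above y xs) ≡⟨ regroup (below x xs) (𝟙 (y <? x)) (inv xs) (above y xs) ⟩
  (below x xs + inv xs) + (𝟙 (y <? x) + above y xs)   ∎
  where
  open ≡-Reasoning
  regroup : ∀ b c i a → (b + (c + 0)) + (i + a) ≡ (b + i) + (c + a)
  regroup = solve 4 (λ b c i a → (b :+ (c :+ con 0)) :+ (i :+ a) := (b :+ i) :+ (c :+ a)) refl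

inv-++ : ∀ xs ys → inv (xs ++ ys) ≡ inv xs + inv ys + crossInv xs ys
inv-++ []       ys = sym (+-identityʳ (inv ys))
inv-++ (x ∷ xs) ys = begin
  below x (xs ++ ys) + inv (xs ++ ys)                      ≡⟨ cong₂ _+_ (tally-++ _ xs ys) (inv-++ xs ys) ⟩
  (below x xs + below x ys) + (inv xs + inv ys + crossInv xs ys)
    ≡⟨ regroup (below x xs) (below x ys) (inv xs) (inv ys) (crossInv xs ys) ⟩
  (below x xs + inv xs) + inv ys + (below x ys + crossInv xs ys) ∎
  where
  open ≡-Reasoning
  regroup : ∀ b c i j k → (b + c) + (i + j + k) ≡ (b + i) + j + (c + k)
  regroup = solve 5 (λ b c i j k → (b :+ c) :+ (i :+ j :+ k) := (b :+ i) :+ j :+ (c :+ k)) refl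

interval : ℕ → ℕ → List ℕ
interval s zero    = []
interval s (suc k) = s ∷ interval (suc s) k

applyUpTo-interval : ∀ (f : ℕ → ℕ) s k → (∀ i → f i ≡ s + i) → applyUpTo f k ≡ interval s k
applyUpTo-interval f s zero    f≗s+ = refl
applyUpTo-interval f s (suc k) f≗s+ =
  cong₂ _∷_ (trans (f≗s+ 0) (+-identityʳ s)) (applyUpTo-interval (f ∘ suc) (suc s) k (λ i → trans (f≗s+ (suc i)) (+-suc s i)))

positions≡interval : ∀ m → positions m ≡ interval 1 m
positions≡interval m = trans (map-applyUpTo id suc m) (applyUpTo-interval suc 1 m (λ _ → refl))

positions-∷ʳ : ∀ m → positions (suc m) ≡ positions m ∷ʳ suc m
positions-∷ʳ m = trans (cong (map suc) (sym (applyUpTo-∷ʳ id m))) (map-++ suc (upTo m) (m ∷ []))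

interval-++ : ∀ s k j → interval s (k + j) ≡ interval s k ++ interval (s + k) j
interval-++ s zero    j = cong (λ t → interval t j) (sym (+-identityʳ s))
interval-++ s (suc k) j = cong (s ∷_) (trans (interval-++ (suc s) k j) (cong (λ t → interval (suc s) k ++ interval t j) (sym (+-suc s k))))

occ-interval-below : ∀ {v s} k → v < s → occ v (interval s k) ≡ 0
occ-interval-below zero    v<s = refl
occ-interval-below {v} {s} (suc k) v<s
  rewrite 𝟙-no (s ≟ v) (>⇒≢ v<s) = occ-interval-below k (m<n⇒m<1+n v<s)

occ-interval-above : ∀ {v} s k → s + k ≤ v → occ v (interval s k) ≡ 0
occ-interval-above s zero    s+k≤v = refl
occ-interval-above {v} s (suc k) s+k≤v
  rewrite 𝟙-no (s ≟ v) (<⇒≢ (<-≤-trans (m<m+n s z<s) s+k≤v)) =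
  occ-interval-above (suc s) k (subst (_≤ v) (+-suc s k) s+k≤v)

occ-interval-inside : ∀ {v} s k → s ≤ v → v < s + k → occ v (interval s k) ≡ 1
occ-interval-inside s zero s≤v v<s+0 = ⊥-elim (<⇒≱ (subst (_ <_) (+-identityʳ s) v<s+0) s≤v)
occ-interval-inside {v} s (suc k) s≤v v<s+k with s ≟ v
... | yes refl = cong suc (occ-interval-below k (n<1+n s))
... | no s≢v   = occ-interval-inside (suc s) k (≤∧≢⇒< s≤v s≢v) (subst (v <_) (+-suc s k) v<s+k)

occ-interval≤1 : ∀ v s k → occ v (interval s k) ≤ 1
occ-interval≤1 v s k with v <? s | v <? s + k
... | yes v<s | _ rewrite occ-interval-below k v<s = z≤n
... | no v≮s  | yes v<s+k rewrite occ-interval-inside s k (≮⇒≥ v≮s) v<s+k = ≤-refl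
... | no _    | no v≮s+k rewrite occ-interval-above s k (≮⇒≥ v≮s+k) = z≤n

occ-interval-swap : ∀ {a} v k → 1 ≤ a → a < k → occ (swap a v) (interval 1 k) ≡ occ v (interval 1 k)
occ-interval-swap {a} v k 1≤a a<k with swapCase a v
... | at-self rewrite swap-self a =
  trans (occ-interval-inside 1 k (s≤s z≤n) (s≤s a<k)) (sym (occ-interval-inside 1 k 1≤a (m<n⇒m<1+n a<k)))
... | at-suc rewrite swap-suc a =
  trans (occ-interval-inside 1 k 1≤a (m<n⇒m<1+n a<k)) (sym (occ-interval-inside 1 k (s≤s z≤n) (s≤s a<k)))
... | elsewhere v≢a v≢1+a = cong (λ u → occ u (interval 1 k)) (swap-other v≢a v≢1+a)

below-interval≡0 : ∀ {x s} k → x ≤ s → below x (interval s k) ≡ 0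
below-interval≡0 zero    x≤s = refl
below-interval≡0 {x} {s} (suc k) x≤s rewrite 𝟙-no (s <? x) (≤⇒≯ x≤s) = below-interval≡0 k (m≤n⇒m≤1+n x≤s)

crossInv-interval≡0 : ∀ s k {t} j → s + k ≤ t → crossInv (interval s k) (interval t j) ≡ 0
crossInv-interval≡0 s zero    j s+k≤t = refl
crossInv-interval≡0 s (suc k) {t} j s+k≤t =
  cong₂ _+_ (below-interval≡0 j (≤-trans (m≤m+n s (suc k)) s+k≤t))
            (crossInv-interval≡0 (suc s) k j (subst (_≤ t) (+-suc s k) s+k≤t))

map-cong-interval : ∀ {f g : ℕ → ℕ} s k → (∀ x → s ≤ x → x < s + k → f x ≡ g x) →
                    map f (interval s k) ≡ map g (interval s k)
map-cong-interval s zero    f≗g = refl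
map-cong-interval s (suc k) f≗g =
  cong₂ _∷_ (f≗g s ≤-refl (m<m+n s z<s))
            (map-cong-interval (suc s) k (λ x s<x x<s+k → f≗g x (<⇒≤ s<x) (subst (x <_) (sym (+-suc s k)) x<s+k)))

inversions≡inv : ∀ m w → inversions m w ≡ inv (map w (positions m))
inversions≡inv zero    w = refl
inversions≡inv (suc m) w = begin
  tally later (positions (suc m))                       ≡⟨ cong (tally later) (positions-∷ʳ m) ⟩
  tally later (positions m ∷ʳ suc m)                    ≡⟨ tally-++ later (positions m) (suc m ∷ []) ⟩
  inversions m w + (later (suc m) + 0)                  ≡⟨ cong₂ _+_ (inversions≡inv m w) (+-identityʳ _) ⟩
  inv (map w (positions m)) + later (suc m)
    ≡⟨ cong (inv (map w (positions m)) +_) (length-filter≡above w (w (suc m)) (positions m)) ⟩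
  inv (map w (positions m)) + above (w (suc m)) (map w (positions m)) ≡⟨ inv-∷ʳ (map w (positions m)) (w (suc m)) ⟨
  inv (map w (positions m) ∷ʳ w (suc m))                ≡⟨ cong inv (map-++ w (positions m) (suc m ∷ [])) ⟨
  inv (map w (positions m ∷ʳ suc m))                    ≡⟨ cong (inv ∘ map w) (positions-∷ʳ m) ⟨
  inv (map w (positions (suc m)))                       ∎
  where
  open ≡-Reasoning
  later : ℕ → ℕ
  later j = length (filter (λ i → w j <? w i) (positions (j ∸ 1)))

everyOther : ℕ → ℕ → List ℕ
everyOther s zero    = []
everyOther s (suc k) = s ∷ everyOther (suc (suc s)) k

everyOther-shift : ∀ s j → s + (suc j + suc j) ≡ suc (suc s) + (j + j)
everyOther-shift = solve 2 (λ s j → s :+ ((con 1 :+ j) :+ (con 1 :+ j)) := con 2 :+ s :+ (j :+ j)) refl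

map-interval≡everyOther : ∀ {f : ℕ → ℕ} s k t → (∀ i → i < k → f (s + i) ≡ t + (i + i)) →
                          map f (interval s k) ≡ everyOther t k
map-interval≡everyOther         s zero    t f≗ = refl
map-interval≡everyOther {f = f} s (suc k) t f≗ =
  cong₂ _∷_ (trans (cong f (sym (+-identityʳ s))) (trans (f≗ 0 z<s) (+-identityʳ t)))
            (map-interval≡everyOther (suc s) k (suc (suc t))
               (λ i i<k → trans (cong f (sym (+-suc s i))) (trans (f≗ (suc i) (s≤s i<k)) (everyOther-shift t i))))

below-everyOther≡0 : ∀ {x s} k → x ≤ s → below x (everyOther s k) ≡ 0
below-everyOther≡0 zero    x≤s = refl
below-everyOther≡0 {x} {s} (suc k) x≤s
  rewrite 𝟙-no (s <? x) (≤⇒≯ x≤s) = below-everyOther≡0 k (m≤n⇒m≤1+n (m≤n⇒m≤1+n x≤s))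

inv-everyOther : ∀ s k → inv (everyOther s k) ≡ 0
inv-everyOther s zero    = refl
inv-everyOther s (suc k) = cong₂ _+_ (below-everyOther≡0 k (m≤n⇒m≤1+n (n≤1+n s))) (inv-everyOther (suc (suc s)) k)

everyOther-member : ∀ s k v → occ v (everyOther s k) ≢ 0 → ∃ λ j → j < k × v ≡ s + (j + j)
everyOther-member s zero    v v∈ = ⊥-elim (v∈ refl)
everyOther-member s (suc k) v v∈ with s ≟ v
... | yes refl = 0 , z<s , sym (+-identityʳ s)
... | no _ with everyOther-member (suc (suc s)) k v v∈
...   | j , j<k , v≡ = suc j , s≤s j<k , trans v≡ (sym (everyOther-shift s j))

everyOther-occ : ∀ s k j → j < k → occ (s + (j + j)) (everyOther s k) ≢ 0
everyOther-occ s (suc k) zero    _         e =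
  1+n≢0 (trans (sym (cong (_+ occ (s + 0) (everyOther (suc (suc s)) k)) (𝟙-yes (s ≟ s + 0) (sym (+-identityʳ s))))) e)
everyOther-occ s (suc k) (suc j) (s≤s j<k) e =
  everyOther-occ (suc (suc s)) k j j<k
    (subst (λ v → occ v (everyOther (suc (suc s)) k) ≡ 0) (everyOther-shift s j) (m+n≡0⇒n≡0 (𝟙 (s ≟ s + (suc j + suc j))) e))

everyOther-no-neighbours : ∀ s k x → occ x (everyOther s k) ≢ 0 → occ (suc x) (everyOther s k) ≢ 0 → ⊥
everyOther-no-neighbours s k x x∈ x+1∈ with everyOther-member s k x x∈ | everyOther-member s k (suc x) x+1∈
... | j , _ , refl | j′ , _ , e = odd≢even j j′ (+-cancelˡ-≡ s _ _ (trans (+-suc s (j + j)) e))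

evens-two-below : ∀ h y → 1 ≤ y → occ (suc (suc y)) (everyOther 2 h) ≢ 0 → occ y (everyOther 2 h) ≢ 0
evens-two-below h y 1≤y y+2∈ with everyOther-member 2 h (suc (suc y)) y+2∈
... | zero   , _ , e = ⊥-elim (<⇒≢ 1≤y (sym (suc-injective (suc-injective e))))
... | suc j  , j<h , e =
  subst (λ v → occ v (everyOther 2 h) ≢ 0) (sym (trans (suc-injective (suc-injective e)) (everyOther-shift 0 j)))
        (everyOther-occ 2 h j (<-trans (n<1+n j) j<h))

WordOver : ℕ → List ℕ → Set
WordOver m = All (λ a → 1 ≤ a × a < m)

occ-evalWord : ∀ {m} s → WordOver m s → ∀ v → occ v (map (evalWord s) (interval 1 m)) ≡ occ v (interval 1 m)
occ-evalWord {m} []      []                  v = cong (occ v) (map-id (interval 1 m))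
occ-evalWord {m} (a ∷ s) ((1≤a , a<m) ∷ ws) v = begin
  occ v (map (evalWord (a ∷ s)) (interval 1 m))         ≡⟨ cong (occ v) (map-∘ (interval 1 m)) ⟩
  occ v (map (swap a) (map (evalWord s) (interval 1 m))) ≡⟨ occ-map-swap a v (map (evalWord s) (interval 1 m)) ⟩
  occ (swap a v) (map (evalWord s) (interval 1 m))      ≡⟨ occ-evalWord s ws (swap a v) ⟩
  occ (swap a v) (interval 1 m)                          ≡⟨ occ-interval-swap v m 1≤a a<m ⟩
  occ v (interval 1 m)                                   ∎
  where open ≡-Reasoning

record Hop (a : ℕ) (C : List ℕ) : Set where
  constructor mkHop
  field
    positive : 1 ≤ a
    occupied : occ (suc a) C ≡ 1
    vacant   : occ a C ≡ 0

-- A configuration C is a list of occupied sites.  Run I C u says that the letters of u, read from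
-- left to right, each move a particle of C from site a + 1 to the empty site a, ending in I.
data Run (I : List ℕ) : List ℕ → List ℕ → Set where
  done : Run I I []
  hop  : ∀ {a C u} → Hop a C → Run I (map (swap a) C) u → Run I C (a ∷ u)

module Halves (h : ℕ) where

  left right : List ℕ → List ℕ
  left  s = map (evalWord s) (interval 1 h)
  right s = map (evalWord s) (interval (suc h) h)

  crossings : List ℕ → ℕ
  crossings s = crossInv (left s) (right s)

  left-[] : left [] ≡ interval 1 h
  left-[] = map-id (interval 1 h)

  crossings-[] : crossings [] ≡ 0
  crossings-[] = trans (cong₂ crossInv left-[] (map-id (interval (suc h) h))) (crossInv-interval≡0 1 h h ≤-refl)

  left-∷ : ∀ a s → left (a ∷ s) ≡ map (swap a) (left s)
  left-∷ a s = map-∘ (interval 1 h)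

  crossings-∷ : ∀ a s → crossings (a ∷ s) + occ (suc a) (left s) * occ a (right s)
                      ≡ crossings s + occ a (left s) * occ (suc a) (right s)
  crossings-∷ a s rewrite left-∷ a s | map-∘ {g = swap a} {f = evalWord s} (interval (suc h) h) =
    crossInv-map-swap a (left s) (right s)

  halves : ∀ (f : ℕ → ℕ) → map f (interval 1 h) ++ map f (interval (suc h) h) ≡ map f (interval 1 (h + h))
  halves f = trans (sym (map-++ f (interval 1 h) (interval (suc h) h))) (cong (map f) (sym (interval-++ 1 h h)))

  occ-halves≤1 : ∀ s → WordOver (h + h) s → ∀ v → occ v (left s) + occ v (right s) ≤ 1
  occ-halves≤1 s ws v = begin
    occ v (left s) + occ v (right s)                              ≡⟨ tally-++ _ (left s) (right s) ⟨
    occ v (left s ++ right s)                                     ≡⟨ cong (occ v) (halves (evalWord s)) ⟩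
    occ v (map (evalWord s) (interval 1 (h + h)))                 ≡⟨ occ-evalWord s ws v ⟩
    occ v (interval 1 (h + h))                                    ≤⟨ occ-interval≤1 v 1 (h + h) ⟩
    1                                                             ∎
    where open ≤-Reasoning

  gain≤1 : ∀ a s → WordOver (h + h) s → occ a (left s) * occ (suc a) (right s) ≤ 1
  gain≤1 a s ws = *-mono-≤ {x = occ a (left s)} {1} {occ (suc a) (right s)} {1}
    (m+n≤o⇒m≤o _ (occ-halves≤1 s ws a)) (m+n≤o⇒n≤o _ (occ-halves≤1 s ws (suc a)))

  crossings≤length : ∀ s → WordOver (h + h) s → crossings s ≤ length s
  crossings≤length []      []       = ≤-reflexive crossings-[]
  crossings≤length (a ∷ s) (_ ∷ ws) = begin
    crossings (a ∷ s)                                                      ≤⟨ m≤m+n _ _ ⟩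
    crossings (a ∷ s) + occ (suc a) (left s) * occ a (right s)            ≡⟨ crossings-∷ a s ⟩
    crossings s + occ a (left s) * occ (suc a) (right s)                  ≤⟨ +-mono-≤ (crossings≤length s ws) (gain≤1 a s ws) ⟩
    length s + 1                                                           ≡⟨ +-comm (length s) 1 ⟩
    length (a ∷ s)                                                         ∎
    where open ≤-Reasoning

  tight⇒run : ∀ s → WordOver (h + h) s → crossings s ≡ length s → Run (interval 1 h) (left s) s
  tight⇒run []      []                 _     = subst (λ C → Run (interval 1 h) C []) (sym left-[]) done
  tight⇒run (a ∷ s) ((1≤a , _) ∷ ws) tight
    with tight-step (crossings-∷ a s) tight (crossings≤length s ws) (gain≤1 a s ws)
  ... | gain≡1 , tight-s =
    hop (mkHop 1≤a a+1∈left′ a∉left′) (subst (λ C → Run (interval 1 h) C s) left-back (tight⇒run s ws tight-s))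
    where
    a∈left : occ a (left s) ≡ 1
    a∈left = m*n≡1⇒m≡1 (occ a (left s)) (occ (suc a) (right s)) gain≡1
    a+1∈right : occ (suc a) (right s) ≡ 1
    a+1∈right = m*n≡1⇒n≡1 (occ a (left s)) (occ (suc a) (right s)) gain≡1
    a+1∉left : occ (suc a) (left s) ≡ 0
    a+1∉left = n≤0⇒n≡0 (m+n≤o⇒m≤o∸n _
                 (subst (λ k → occ (suc a) (left s) + k ≤ 1) a+1∈right (occ-halves≤1 s ws (suc a))))
    a+1∈left′ : occ (suc a) (left (a ∷ s)) ≡ 1
    a+1∈left′ = trans (cong (occ (suc a)) (left-∷ a s)) (trans (occ-map-swap-suc a (left s)) a∈left)
    a∉left′ : occ a (left (a ∷ s)) ≡ 0
    a∉left′ = trans (cong (occ a) (left-∷ a s)) (trans (occ-map-swap-self a (left s)) a+1∉left)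
    left-back : left s ≡ map (swap a) (left (a ∷ s))
    left-back = sym (trans (cong (map (swap a)) (left-∷ a s)) (map-swap-involutive a (left s)))

hops-far : ∀ {a b C} → Hop a C → Hop b C → a ≢ b → Far a b
hops-far (mkHop _ a+1∈C a∉C) (mkHop _ b+1∈C b∉C) a≢b =
  a≢b , (λ { refl → 1+n≢0 (trans (sym a+1∈C) b∉C) }) , (λ { refl → 1+n≢0 (trans (sym b+1∈C) a∉C) })

Hop-after : ∀ {a b C} → Far a b → Hop b C → Hop b (map (swap a) C)
Hop-after {C = C} (a≢b , 1+a≢b , 1+b≢a) (mkHop 1≤b b+1∈C b∉C) =
  mkHop 1≤b (trans (occ-map-swap-other C 1+b≢a (a≢b ∘ sym ∘ suc-injective)) b+1∈C)
            (trans (occ-map-swap-other C (a≢b ∘ sym) (1+a≢b ∘ sym)) b∉C)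

run-tail : ∀ {I C a u} → Run I C (a ∷ u) → Run I (map (swap a) C) u
run-tail (hop _ r) = r

no-repeat : ∀ {I C a u} → Run I C (a ∷ a ∷ u) → ⊥
no-repeat {C = C} {a} (hop (mkHop _ a+1∈C _) (hop (mkHop _ _ a∉C′) _)) =
  1+n≢0 (trans (sym a+1∈C) (trans (sym (occ-map-swap-self a C)) a∉C′))

no-braid-up : ∀ {I C a u} → Run I C (a ∷ suc a ∷ a ∷ u) → ⊥
no-braid-up {C = C} {a} (hop (mkHop _ a+1∈C _) (hop _ (hop (mkHop _ _ a∉C″) _))) =
  1+n≢0 (trans (sym a+1∈C) (trans (sym (occ-map-swap-self a C))
        (trans (sym (occ-map-swap-other (map (swap a) C) a≢1+a (<⇒≢ (m<n⇒m<1+n (n<1+n a))))) a∉C″)))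

no-braid-down : ∀ {I C a u} → Run I C (suc a ∷ a ∷ suc a ∷ u) → ⊥
no-braid-down {C = C} {a} (hop (mkHop _ _ a+1∉C) (hop _ (hop (mkHop _ a+2∈C″ _) _))) =
  1+n≢0 (trans (sym a+2∈C″) (trans (occ-map-swap-other (map (swap (suc a)) C) (>⇒≢ (m<n⇒m<1+n (n<1+n a))) 1+n≢n)
        (trans (occ-map-swap-suc (suc a) C) a+1∉C)))

descending-pair : ∀ {I C y u} → Run I C (suc y ∷ y ∷ u) → 1 ≤ y × occ (suc (suc y)) C ≡ 1 × occ y C ≡ 0
descending-pair {C = C} {y} (hop (mkHop _ y+2∈C _) (hop (mkHop 1≤y _ y∉C′) _)) =
  1≤y , y+2∈C , trans (sym (occ-map-swap-other C a≢1+a (<⇒≢ (m<n⇒m<1+n (n<1+n y))))) y∉C′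

ascending-pair : ∀ {I C x u} → Run I C (x ∷ suc x ∷ u) → occ (suc x) C ≡ 1 × occ (suc (suc x)) C ≡ 1
ascending-pair {C = C} {x} (hop (mkHop _ x+1∈C _) (hop (mkHop _ x+2∈C′ _) _)) =
  x+1∈C , trans (sym (occ-map-swap-other C (>⇒≢ (m<n⇒m<1+n (n<1+n x))) 1+n≢n)) x+2∈C′

evens-heads-far : ∀ {I h x y u} → Run I (everyOther 2 h) (x ∷ y ∷ u) → Far y x
evens-heads-far {h = h} {x} {y} r = y≢x , 1+y≢x , 1+x≢y
  where
  y≢x : y ≢ x
  y≢x refl = no-repeat r
  1+y≢x : suc y ≢ x
  1+y≢x refl with descending-pair r
  ... | 1≤y , y+2∈ , y∉ = evens-two-below h y 1≤y (≡1⇒≢0 y+2∈) y∉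
  1+x≢y : suc x ≢ y
  1+x≢y refl with ascending-pair r
  ... | x+1∈ , x+2∈ = everyOther-no-neighbours 2 h (suc x) (≡1⇒≢0 x+1∈) (≡1⇒≢0 x+2∈)

-- The two letters exchanged by a Knuth move could only fail to commute if they were adjacent, and
-- then the word would contain aa, a(a+1)a or (a+1)a(a+1), which never label a run.
knuthMove-evalWord : ∀ {I C u v} → Run I C u → KnuthMove u v → ∀ x → evalWord v x ≡ evalWord u x
knuthMove-evalWord r (there move) x = cong (swap _) (knuthMove-evalWord (run-tail r) move x)
knuthMove-evalWord {I} {C} r (here {rest = rest} (k1 {a} {b} {c} a≤b b<c)) x =
  swap-comm (Far-sym (<-far (≤-<-trans a≤b b<c) adjacent)) (swap b (evalWord rest x))
  where
  adjacent : suc a ≢ c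
  adjacent refl = no-braid-up (subst (λ z → Run I C (a ∷ suc a ∷ z ∷ rest)) (≤-antisym (m<1+n⇒m≤n b<c) a≤b) r)
knuthMove-evalWord {I} {C} r (here {rest = rest} (k1⁻ {a} {b} {c} a≤b b<c)) x =
  swap-comm (<-far (≤-<-trans a≤b b<c) adjacent) (swap b (evalWord rest x))
  where
  adjacent : suc a ≢ c
  adjacent refl = no-repeat (subst (λ z → Run I _ (a ∷ z ∷ rest)) (≤-antisym (m<1+n⇒m≤n b<c) a≤b) (run-tail r))
knuthMove-evalWord {I} {C} r (here {rest = rest} (k2 {a} {b} {c} a<b b≤c)) x =
  cong (swap b) (swap-comm (Far-sym (<-far (<-≤-trans a<b b≤c) adjacent)) (evalWord rest x))
  where
  adjacent : suc a ≢ c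
  adjacent refl = no-braid-down (subst (λ z → Run I C (z ∷ a ∷ suc a ∷ rest)) (≤-antisym b≤c a<b) r)
knuthMove-evalWord {I} {C} r (here {rest = rest} (k2⁻ {a} {b} {c} a<b b≤c)) x =
  cong (swap b) (swap-comm (<-far (<-≤-trans a<b b≤c) adjacent) (evalWord rest x))
  where
  adjacent : suc a ≢ c
  adjacent refl = no-repeat (subst (λ z → Run I C (z ∷ suc a ∷ a ∷ rest)) (≤-antisym b≤c a<b) r)

knuthMove-All : ∀ {P : ℕ → Set} {u v} → KnuthMove u v → All P u → All P v
knuthMove-All (there move)     (p ∷ ps)         = p ∷ knuthMove-All move ps
knuthMove-All (here (k1 _ _))  (px ∷ py ∷ pz ∷ ps) = py ∷ px ∷ pz ∷ ps
knuthMove-All (here (k1⁻ _ _)) (px ∷ py ∷ pz ∷ ps) = py ∷ px ∷ pz ∷ ps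
knuthMove-All (here (k2 _ _))  (px ∷ py ∷ pz ∷ ps) = px ∷ pz ∷ py ∷ ps
knuthMove-All (here (k2⁻ _ _)) (px ∷ py ∷ pz ∷ ps) = px ∷ pz ∷ py ∷ ps

knuthMove-length : ∀ {u v} → KnuthMove u v → length u ≡ length v
knuthMove-length (there move)     = cong suc (knuthMove-length move)
knuthMove-length (here (k1 _ _))  = refl
knuthMove-length (here (k1⁻ _ _)) = refl
knuthMove-length (here (k2 _ _))  = refl
knuthMove-length (here (k2⁻ _ _)) = refl

knuthMove-reduced : ∀ {m w I C u v} → Run I C u → IsReducedWord m w u → KnuthMove u v → IsReducedWord m w v
knuthMove-reduced r (ws , u≗w , len) move =
  knuthMove-All move ws
  , (λ x 1≤x x≤m → trans (knuthMove-evalWord r move x) (u≗w x 1≤x x≤m))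
  , trans (sym (knuthMove-length move)) len

swapHead-reduced : ∀ {m w x y rest} → Far y x → IsReducedWord m w (x ∷ y ∷ rest) → IsReducedWord m w (y ∷ x ∷ rest)
swapHead-reduced {rest = rest} far (px ∷ py ∷ ps , u≗w , len) =
  py ∷ px ∷ ps , (λ z 1≤z z≤m → trans (swap-comm far (evalWord rest z)) (u≗w z 1≤z z≤m)) , len

lift : ∀ {a u v} → Star KnuthMove u v → Star KnuthMove (a ∷ u) (a ∷ v)
lift {a} = gmap (a ∷_) there

star-length : ∀ {u v} → Star KnuthMove u v → length u ≡ length v
star-length = fold (λ u v → length u ≡ length v) (λ move → trans (knuthMove-length move)) refl

module Connectivity (I : List ℕ) (I-stuck : ∀ a → ¬ Hop a I) (I-distinct : ∀ v → occ v I ≤ 1) where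

  complete : ∀ {C w b} → Run I C w → Hop b C → ∃ λ t → Run I (map (swap b) C) t
  complete {b = b} done Hb = ⊥-elim (I-stuck b Hb)
  complete {C} {d ∷ w} {b} (hop Hd r) Hb with d ≟ b
  ... | yes refl = w , r
  ... | no d≢b   = d ∷ proj₁ rest , hop (Hop-after (Far-sym far) Hd)
                                         (subst (λ D → Run I D (proj₁ rest)) (map-swap-comm b d C (Far-sym far)) (proj₂ rest))
    where
    far : Far d b
    far = hops-far Hd Hb d≢b
    rest : ∃ λ t → Run I (map (swap b) (map (swap d) C)) t
    rest = complete r (Hop-after far Hb)

  run-occ≤1 : ∀ {C u} → Run I C u → ∀ v → occ v C ≤ 1
  run-occ≤1 done v = I-distinct v
  run-occ≤1 {C} (hop {a = a} _ r) v =
    subst (λ x → occ x C ≤ 1) (swap-involutive a v) (subst (_≤ 1) (occ-map-swap a (swap a v) C) (run-occ≤1 r (swap a v)))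

  record Bridge (C : List ℕ) (lo hi : ℕ) : Set where
    field
      c     : ℕ
      t     : List ℕ
      lo≤c  : lo ≤ c
      c<hi  : c < hi
      via-lo : Run I (map (swap lo) C) (hi ∷ c ∷ t)
      via-hi : Run I (map (swap hi) C) (lo ∷ c ∷ t)

  bridge : ∀ {C lo hi u} → lo < hi → Hop lo C → Hop hi C → Run I (map (swap lo) C) u → Bridge C lo hi
  bridge {C} {lo} {hi} lo<hi Hlo Hhi r = from-rise (discrete-ivt (λ v → occ v D ≟ 1) hi 1+lo<hi 1+lo∉D hi∈D)
    where
    far : Far lo hi
    far = hops-far Hlo Hhi (<⇒≢ lo<hi)
    1+lo≢hi : suc lo ≢ hi
    1+lo≢hi = proj₁ (proj₂ far)
    1+lo<hi : suc lo < hi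
    1+lo<hi = ≤∧≢⇒< lo<hi 1+lo≢hi
    Hhi′ : Hop hi (map (swap lo) C)
    Hhi′ = Hop-after far Hhi
    Hlo′ : Hop lo (map (swap hi) C)
    Hlo′ = Hop-after (Far-sym far) Hlo
    D : List ℕ
    D = map (swap hi) (map (swap lo) C)
    rD : Run I D (proj₁ (complete r Hhi′))
    rD = proj₂ (complete r Hhi′)
    1+lo∉D : ¬ occ (suc lo) D ≡ 1
    1+lo∉D 1+lo∈D = 1+n≢0 (trans (sym 1+lo∈D)
      (trans (occ-map-swap-other (map (swap lo) C) 1+lo≢hi (<⇒≢ lo<hi ∘ suc-injective))
             (trans (occ-map-swap-suc lo C) (Hop.vacant Hlo))))
    hi∈D : occ hi D ≡ 1
    hi∈D = trans (occ-map-swap-self hi (map (swap lo) C)) (Hop.occupied Hhi′)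
    from-rise : (∃ λ c → suc lo ≤ c × c < hi × ¬ occ c D ≡ 1 × occ (suc c) D ≡ 1) → Bridge C lo hi
    from-rise (c , lo<c , c<hi , c∉D , 1+c∈D) = record
      { c = c ; t = proj₁ rest ; lo≤c = <⇒≤ lo<c ; c<hi = c<hi
      ; via-lo = hop Hhi′ (hop Hc (proj₂ rest))
      ; via-hi = hop Hlo′ (subst (λ E → Run I E (c ∷ proj₁ rest)) (map-swap-comm hi lo C (Far-sym far)) (hop Hc (proj₂ rest)))
      }
      where
      Hc : Hop c D
      Hc = mkHop (≤-trans (s≤s z≤n) lo<c) 1+c∈D (≤1∧≢1⇒≡0 (run-occ≤1 rD c) c∉D)
      rest : ∃ λ t → Run I (map (swap c) D) t
      rest = complete rD Hc

  connect : ∀ ℓ {C u v} → length u ≡ ℓ → Run I C u → Run I C v → Star KnuthMove u v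
  through : ∀ ℓ {C a b c t u v} → length u ≡ ℓ → Run I (map (swap a) C) u → Run I (map (swap b) C) v →
            Run I (map (swap a) C) (b ∷ c ∷ t) → Run I (map (swap b) C) (a ∷ c ∷ t) →
            KnuthMove (a ∷ b ∷ c ∷ t) (b ∷ a ∷ c ∷ t) → Star KnuthMove (a ∷ u) (b ∷ v)

  connect _ _ done done = ε
  connect _ _ done (hop {a = b} Hb _) = ⊥-elim (I-stuck b Hb)
  connect _ _ (hop {a = a} Ha _) done = ⊥-elim (I-stuck a Ha)
  connect (suc ℓ) {u = a ∷ _} {b ∷ _} len (hop Ha ru) (hop Hb rv) with <-cmp a b
  ... | tri≈ _ refl _ = lift (connect ℓ (suc-injective len) ru rv)
  ... | tri< a<b _ _  = let open Bridge (bridge a<b Ha Hb ru) in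
                        through ℓ (suc-injective len) ru rv via-lo via-hi (here (k1 lo≤c c<hi))
  ... | tri> _ _ b<a  = let open Bridge (bridge b<a Hb Ha rv) in
                        through ℓ (suc-injective len) ru rv via-hi via-lo (here (k1⁻ lo≤c c<hi))

  through ℓ {b = b} {c} {t} {u} len ru rv r₁ r₂ move =
    lift ru→r₁ ◅◅ move ◅ lift (connect ℓ (trans (sym (star-length ru→r₁)) len) r₂ rv)
    where
    ru→r₁ : Star KnuthMove u (b ∷ c ∷ t)
    ru→r₁ = connect ℓ len ru r₁

interval-stuck : ∀ h a → ¬ Hop a (interval 1 h)
interval-stuck h a (mkHop 1≤a a+1∈ a∉) with a <? h
... | yes a<h = 1+n≢0 (trans (sym (occ-interval-inside 1 h 1≤a (m<n⇒m<1+n a<h))) a∉)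
... | no a≮h  = 1+n≢0 (trans (sym a+1∈) (occ-interval-above 1 h (s≤s (≮⇒≥ a≮h))))

wδ-first : ∀ n i → 1 ≤ i → i ≤ n ∸ 1 → wδ n i ≡ 2 * i
wδ-first n i 1≤i i≤n-1 rewrite ≤ᵇ-true 1≤i | ≤ᵇ-true i≤n-1 = refl

wδ-second : ∀ n i → n ≤ i → i ≤ 2 * n ∸ 2 → ¬ i ≤ n ∸ 1 → wδ n i ≡ 2 * (i ∸ n) + 1
wδ-second n i n≤i i≤2n-2 i≰n-1 rewrite ≤ᵇ-false i≰n-1 | ≤ᵇ-true n≤i | ≤ᵇ-true i≤2n-2 with 1 ≤ᵇ i
... | true  = refl
... | false = refl

module Staircase (k : ℕ) where

  n h : ℕ
  n = suc (suc k)
  h = suc k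

  size : 2 * n ∸ 2 ≡ h + h
  size = solve 1 (λ k → k :+ (con 2 :+ (k :+ con 0)) := con 1 :+ k :+ (con 1 :+ k)) refl k

  wδ-left : map (wδ n) (interval 1 h) ≡ everyOther 2 h
  wδ-left = map-interval≡everyOther 1 h 2 (λ i i<h → trans (wδ-first n (suc i) (s≤s z≤n) i<h) (double i))
    where
    double : ∀ i → 2 * suc i ≡ 2 + (i + i)
    double = solve 1 (λ i → con 2 :* (con 1 :+ i) := con 2 :+ (i :+ i)) refl

  wδ-right : map (wδ n) (interval (suc h) h) ≡ everyOther 1 h
  wδ-right = map-interval≡everyOther (suc h) h 1 value
    where
    value : ∀ i → i < h → wδ n (n + i) ≡ 1 + (i + i)
    value i i<h = begin
      wδ n (n + i)           ≡⟨ wδ-second n (n + i) (m≤m+n n i) in-range (λ le → <⇒≱ (s≤s (m≤m+n h i)) le) ⟩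
      2 * (n + i ∸ n) + 1    ≡⟨ cong (λ j → 2 * j + 1) (m+n∸m≡n n i) ⟩
      2 * i + 1              ≡⟨ solve 1 (λ i → con 2 :* i :+ con 1 := con 1 :+ (i :+ i)) refl i ⟩
      1 + (i + i)            ∎
      where
      open ≡-Reasoning
      in-range : n + i ≤ 2 * n ∸ 2
      in-range = subst (n + i ≤_) (sym size) (≤-trans (≤-reflexive (sym (+-suc h i))) (+-monoʳ-≤ h i<h))

  reduced⇒run : ∀ u → IsReducedWord (2 * n ∸ 2) (wδ n) u → Run (interval 1 h) (everyOther 2 h) u
  reduced⇒run u (ws , u≗w , len) =
    subst (λ C → Run (interval 1 h) C u) left-u (tight⇒run u (subst (λ m → WordOver m u) size ws) tight)
    where
    open Halves h
    agree : ∀ x → 1 ≤ x → x ≤ h + h → evalWord u x ≡ wδ n x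
    agree x 1≤x x≤h+h = u≗w x 1≤x (subst (x ≤_) (sym size) x≤h+h)
    left-u : left u ≡ everyOther 2 h
    left-u = trans (map-cong-interval 1 h (λ x 1≤x x≤h → agree x 1≤x (≤-trans (m<1+n⇒m≤n x≤h) (m≤m+n h h)))) wδ-left
    right-u : right u ≡ everyOther 1 h
    right-u = trans (map-cong-interval (suc h) h (λ x h<x x≤h+h → agree x (≤-trans (s≤s z≤n) h<x) (m<1+n⇒m≤n x≤h+h)))
                    wδ-right
    tight : crossings u ≡ length u
    tight = sym (begin
      length u                                                    ≡⟨ len ⟩
      inversions (2 * n ∸ 2) (wδ n)                               ≡⟨ cong (λ m → inversions m (wδ n)) size ⟩
      inversions (h + h) (wδ n)                                   ≡⟨ inversions≡inv (h + h) (wδ n) ⟩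
      inv (map (wδ n) (positions (h + h)))                        ≡⟨ cong (inv ∘ map (wδ n)) (positions≡interval (h + h)) ⟩
      inv (map (wδ n) (interval 1 (h + h)))                       ≡⟨ cong inv (halves (wδ n)) ⟨
      inv (map (wδ n) (interval 1 h) ++ map (wδ n) (interval (suc h) h)) ≡⟨ cong inv (cong₂ _++_ wδ-left wδ-right) ⟩
      inv (everyOther 2 h ++ everyOther 1 h)                      ≡⟨ inv-++ (everyOther 2 h) (everyOther 1 h) ⟩
      inv (everyOther 2 h) + inv (everyOther 1 h) + crossInv (everyOther 2 h) (everyOther 1 h)
        ≡⟨ cong₂ (λ p q → p + q + crossInv (everyOther 2 h) (everyOther 1 h)) (inv-everyOther 2 h) (inv-everyOther 1 h) ⟩
      crossInv (everyOther 2 h) (everyOther 1 h)                  ≡⟨ cong₂ crossInv left-u right-u ⟨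
      crossings u                                                 ∎)
      where open ≡-Reasoning

  open Connectivity (interval 1 h) (interval-stuck h) (λ v → occ-interval≤1 v 1 h)

  reduced-closed : ∀ u v → IsReducedWord (2 * n ∸ 2) (wδ n) u → ShiftedKnuthMove u v → IsReducedWord (2 * n ∸ 2) (wδ n) v
  reduced-closed u v red (knuth move)          = knuthMove-reduced (reduced⇒run u red) red move
  reduced-closed (x ∷ y ∷ _) _ red swapHead = swapHead-reduced (evens-heads-far (reduced⇒run _ red)) red

  reduced-connected : ∀ u v → IsReducedWord (2 * n ∸ 2) (wδ n) u → IsReducedWord (2 * n ∸ 2) (wδ n) v →
                      Star ShiftedKnuthMove u v
  reduced-connected u v red-u red-v = map⋆ knuth (connect (length u) refl (reduced⇒run u red-u) (reduced⇒run v red-v))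

proposition3p1 : (n : ℕ) → 2 ≤ n →
    ((u v : List ℕ) → IsReducedWord (2 * n ∸ 2) (wδ n) u → ShiftedKnuthMove u v → IsReducedWord (2 * n ∸ 2) (wδ n) v)
    × ((u v : List ℕ) → IsReducedWord (2 * n ∸ 2) (wδ n) u → IsReducedWord (2 * n ∸ 2) (wδ n) v → Star ShiftedKnuthMove u v)
proposition3p1 (suc (suc k)) (s≤s (s≤s z≤n)) = reduced-closed , reduced-connected
  where open Staircase k
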